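{- Let $G$ be a nice connected graph with $m$ edges, and let $W$ be a closed walk of $G$ of length $p$ that goes through all vertices of $G$. Then ${\rm ML}^{\rm W}(G) \leq p+2m$.
   Context: All graphs are finite and simple. A graph is nice if it is connected and not isomorphic to $K_2$. A walk of $G$ is a sequence of vertices $u_0u_1\dots u_\ell$ in which consecutive vertices are adjacent (vertices and edges may repeat); its length is the number $\ell$ of traversed edges (counted with repetition); it is closed if $u_0=u_\ell$. For a walk $W$, $G+W$ denotes the multigraph on $V(G)$ whose edge multiset consists of $E(G)$ together with all edges traversed by $W$, each added as many times as it is traversed. A multigraph is locally irregular if no two adjacent vertices have the same degree. A walk $W$ of $G$ is irregularising if $G+W$ is locally irregular. ${\rm ML}^{\rm W}(G)$ is the minimum length of an irregularising walk of $G$ (a walk of length $0$ being allowed), and $+\infty$ if none exists. -}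

module Defs where

open import Data.Nat using (ℕ; zero; suc; _+_; _≤_)
open import Data.Bool using (Bool; true; false; if_then_else_)
open import Data.Fin using (Fin; inject₁; _<_) renaming (zero to fz; suc to fs)
open import Data.Fin.Properties using (_≟_)
open import Data.List using (List; map; allFin)
open import Data.Nat.ListAction using (sum)
open import Data.Product using (Σ; ∃; _×_; _,_)
open import Relation.Nullary using (¬_; does)
open import Relation.Binary.PropositionalEquality using (_≡_; _≢_)
open import Function.Bundles using (_⤖_; Bijection)

record Graph (n : ℕ) : Set where
  field
    adj   : Fin n → Fin n → Bool
    sym   : ∀ u v → adj u v ≡ adj v u
    irrefl : ∀ u → adj u u ≡ false
open Graph public

Adj : ∀ {n} → Graph n → Fin n → Fin n → Set
Adj G u v = adj G u v ≡ true

count : ∀ {k} → (Fin k → Bool) → ℕ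
count {k} P = sum (map (λ i → if P i then 1 else 0) (allFin k))

_==_ : ∀ {n} → Fin n → Fin n → Bool
u == v = does (u ≟ v)

deg : ∀ {n} → Graph n → Fin n → ℕ
deg G v = count (adj G v)

numEdges : ∀ {n} → Graph n → ℕ
numEdges {n} G =
  sum (map (λ u → count (λ v → does (u Data.Fin.<? v) Data.Bool.∧ adj G u v)) (allFin n))

record Walk {n : ℕ} (G : Graph n) (ℓ : ℕ) : Set where
  field
    vtx  : Fin (suc ℓ) → Fin n
    step : ∀ (i : Fin ℓ) → Adj G (vtx (inject₁ i)) (vtx (fs i))
open Walk public

first : ∀ {n} {G : Graph n} {ℓ} → Walk G ℓ → Fin n
first W = vtx W fz

last : ∀ {n} {G : Graph n} {ℓ} → Walk G ℓ → Fin n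
last {ℓ = ℓ} W = vtx W (Data.Fin.fromℕ ℓ)

Closed : ∀ {n} {G : Graph n} {ℓ} → Walk G ℓ → Set
Closed W = first W ≡ last W

Spanning : ∀ {n} {G : Graph n} {ℓ} → Walk G ℓ → Set
Spanning {n} W = ∀ (v : Fin n) → ∃ λ i → vtx W i ≡ v

-- number of traversed edges (with repetition) incident to v; since consecutive
-- walk vertices are adjacent hence distinct, each traversal of an edge at v
-- contributes exactly 1.
walkDeg : ∀ {n} {G : Graph n} {ℓ} → Walk G ℓ → Fin n → ℕ
walkDeg W v = count (λ i → vtx W (inject₁ i) == v) + count (λ i → vtx W (fs i) == v)

-- degree of v in the multigraph G + W
degPlus : ∀ {n} {G : Graph n} {ℓ} → Walk G ℓ → Fin n → ℕ
degPlus {G = G} W v = deg G v + walkDeg W v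

-- G + W is locally irregular. Its underlying adjacency equals that of G,
-- since W only traverses edges of G.
Irregularising : ∀ {n} {G : Graph n} {ℓ} → Walk G ℓ → Set
Irregularising {n} {G} W = ∀ (u v : Fin n) → Adj G u v → degPlus W u ≢ degPlus W v

Connected : ∀ {n} → Graph n → Set
Connected {n} G = ∀ (u v : Fin n) → ∃ λ ℓ → Σ (Walk G ℓ) λ W → first W ≡ u × last W ≡ v

Isomorphic : ∀ {n k} → Graph n → Graph k → Set
Isomorphic {n} {k} G H =
  Σ (Fin n ⤖ Fin k) λ f → ∀ u v → adj G u v ≡ adj H (Bijection.to f u) (Bijection.to f v)

K₂ : Graph 2
K₂ = record { adj = a ; sym = s ; irrefl = r }
  where
  a : Fin 2 → Fin 2 → Bool
  a fz fz = false
  a fz (fs fz) = true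
  a (fs fz) fz = true
  a (fs fz) (fs fz) = false
  s : ∀ u v → a u v ≡ a v u
  s fz fz = _≡_.refl
  s fz (fs fz) = _≡_.refl
  s (fs fz) fz = _≡_.refl
  s (fs fz) (fs fz) = _≡_.refl
  r : ∀ u → a u u ≡ false
  r fz = _≡_.refl
  r (fs fz) = _≡_.refl

Nice : ∀ {n} → Graph n → Set
Nice G = Connected G × ¬ Isomorphic G K₂

-- ML^W(G) ≤ k  :⇔  some irregularising walk has length ≤ k
-- (ML^W is the minimum of such lengths, +∞ if none exists).
MLW≤ : ∀ {n} → Graph n → ℕ → Set
MLW≤ G k = ∃ λ ℓ → ℓ ≤ k × Σ (Walk G ℓ) Irregularising

{-# OPTIONS --safe #-}

-- Pick a vertex r with two neighbours s and w, and order the vertices by growing a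
-- spanning tree from w, s, r, each new vertex x being attached to an earlier neighbour y.
-- The vertices are then settled in the reverse order: x gets t round trips x y x, inserted
-- into W where it visits x, which raises the degrees of x and y by 2 t and changes no other
-- degree. As y is settled later, settled vertices keep their degrees, so t only has to avoid
-- one value per settled neighbour of x, and some t bounded by their number does: every edge
-- pays for at most one round trip. At the end w must also keep s and r apart, because s and r
-- are settled together by round trips along sr, which cannot separate them; the edge sr pays
-- for that extra value. So at most m round trips, i.e. 2 m steps, are added to W.

module Submission where

open import Defs hiding (sym)

open import Data.Bool using (Bool; true; false; if_then_else_; _∧_; _∨_; not; T; T?)
open import Data.Bool.Properties using (∧-zeroʳ)
open import Data.Empty using (⊥-elim)
open import Data.Fin using (Fin; toℕ; inject₁; _<?_) renaming (zero to fz; suc to fs)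
open import Data.Fin.Properties
  using (_≟_; all?; any?; ¬∀⟶∃¬; pigeonhole; toℕ-injective; toℕ≤pred[n]; <-cmp)
  renaming (<⇒≢ to <⇒≢ᶠ)
open import Data.List
  using (List; []; _∷_; _++_; map; length; tabulate; lookup; filterᵇ; allFin)
open import Data.List.Properties
  using (length-map; length-++; map-tabulate; map-cong; tabulate-lookup; length-tabulate)
open import Data.List.Membership.Propositional using (_∈_; _∉_)
open import Data.List.Membership.Propositional.Properties
  using (∈-map⁺; ∈-filter⁺; ∈-allFin; ∈-tabulate⁺; ∈-∃++; ∈-++⁺ˡ; ∈-++⁺ʳ)
import Data.List.Membership.DecPropositional as DecMembership
open import Data.List.Relation.Unary.Any using (here; there; index)
open import Data.List.Relation.Unary.Any.Properties using (lookup-index)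
open import Data.List.Relation.Unary.Linked using (Linked; [-]; _∷_)
open import Data.Nat using (ℕ; zero; suc; _+_; _*_; _∸_; _/_; _≤_; z≤n; s≤s)
open import Data.Nat.ListAction using (sum)
open import Data.Nat.DivMod using (m*n/n≡m)
open import Data.Nat.Properties
  using ( +-0-commutativeMonoid; +-commutativeSemigroup; +-identityʳ; +-comm; +-assoc; *-comm
        ; *-identityʳ; *-zeroʳ; +-monoʳ-≤; *-monoʳ-≤; +-cancelʳ-≡; suc-injective; m+n∸m≡n
        ; n<1+n; ≤-reflexive; module ≤-Reasoning)
open import Data.Nat.Tactic.RingSolver using (solve-∀)
open import Data.Product using (Σ; ∃; ∃₂; _×_; _,_; proj₁; proj₂)
open import Data.Sum using (_⊎_; inj₁; inj₂)
open import Data.Unit using (tt)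
open import Function using (_∘_)
open import Function.Construct.Identity using (⤖-id)
open import Relation.Binary.Definitions using (tri<; tri≈; tri>)
open import Relation.Binary.PropositionalEquality
open import Relation.Nullary using (¬_; yes; no; does; contradiction)
open import Relation.Nullary.Decidable using (dec-true; dec-false; decidable-stable; ¬?)

open import Algebra.Properties.CommutativeMonoid.Sum +-0-commutativeMonoid
  using (sum-syntax; sum-cong-≗; ∑-distrib-+; sum-replicate-zero)
open import Algebra.Properties.CommutativeSemigroup +-commutativeSemigroup using (interchange)

open DecMembership Data.Nat._≟_ using () renaming (_∈?_ to _∈ℕ?_)

-- Counting

⟦_⟧ : Bool → ℕ
⟦ b ⟧ = if b then 1 else 0

sum-tabulate : ∀ {k} (f : Fin k → ℕ) → sum (tabulate f) ≡ ∑[ i < k ] f i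
sum-tabulate {zero}  f = refl
sum-tabulate {suc k} f = cong (f fz +_) (sum-tabulate (f ∘ fs))

sum-allFin : ∀ {k} (f : Fin k → ℕ) → sum (map f (allFin k)) ≡ ∑[ i < k ] f i
sum-allFin f = trans (cong sum (map-tabulate (λ i → i) f)) (sum-tabulate f)

count≡∑ : ∀ {k} (P : Fin k → Bool) → count P ≡ ∑[ i < k ] ⟦ P i ⟧
count≡∑ P = sum-allFin (λ i → ⟦ P i ⟧)

count-suc : ∀ {k} (P : Fin (suc k) → Bool) → count P ≡ ⟦ P fz ⟧ + count (P ∘ fs)
count-suc P = trans (count≡∑ P) (cong (⟦ P fz ⟧ +_) (sym (count≡∑ (P ∘ fs))))

count-cong : ∀ {k} {P Q : Fin k → Bool} → (∀ i → P i ≡ Q i) → count P ≡ count Q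
count-cong P≗Q = cong sum (map-cong (λ i → cong ⟦_⟧ (P≗Q i)) (allFin _))

count-+ : ∀ {k} {P Q R : Fin k → Bool} →
          (∀ i → ⟦ P i ⟧ + ⟦ Q i ⟧ ≡ ⟦ R i ⟧) → count P + count Q ≡ count R
count-+ {k} {P} {Q} {R} split = begin
  count P + count Q
    ≡⟨ cong₂ _+_ (count≡∑ P) (count≡∑ Q) ⟩
  ∑[ i < k ] ⟦ P i ⟧ + ∑[ i < k ] ⟦ Q i ⟧
    ≡⟨ sym (∑-distrib-+ (λ i → ⟦ P i ⟧) (λ i → ⟦ Q i ⟧)) ⟩
  ∑[ i < k ] (⟦ P i ⟧ + ⟦ Q i ⟧)
    ≡⟨ sum-cong-≗ split ⟩
  ∑[ i < k ] ⟦ R i ⟧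
    ≡⟨ sym (count≡∑ R) ⟩
  count R
    ∎
  where open ≡-Reasoning

∑-δ : ∀ {k} (j : Fin k) (f : Fin k → ℕ) → ∑[ i < k ] (if i == j then f i else 0) ≡ f j
∑-δ {suc k} fz     f = trans (cong (f fz +_) (sum-replicate-zero k)) (+-identityʳ (f fz))
∑-δ {suc k} (fs j) f = ∑-δ j (f ∘ fs)

insert : ∀ {n} → Fin n → (Fin n → Bool) → Fin n → Bool
insert x U v = (v == x) ∨ U v

insert-true : ∀ {n} {x : Fin n} {U v} → insert x U v ≡ true → v ≡ x ⊎ U v ≡ true
insert-true {x = x} {v = v} v∈ with v ≟ x
... | yes v≡x = inj₁ v≡x
... | no  _   = inj₂ v∈

count-insert : ∀ {n} {x : Fin n} {U} → U x ≡ false → (P : Fin n → Bool) →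
               count (λ v → insert x U v ∧ P v) ≡ ⟦ P x ⟧ + count (λ v → U v ∧ P v)
count-insert {n} {x} {U} Ux P = begin
  count (λ v → insert x U v ∧ P v)
    ≡⟨ count≡∑ (λ v → insert x U v ∧ P v) ⟩
  ∑[ v < n ] ⟦ insert x U v ∧ P v ⟧
    ≡⟨ sum-cong-≗ split ⟩
  ∑[ v < n ] ((if v == x then ⟦ P v ⟧ else 0) + ⟦ U v ∧ P v ⟧)
    ≡⟨ ∑-distrib-+ (λ v → if v == x then ⟦ P v ⟧ else 0) (λ v → ⟦ U v ∧ P v ⟧) ⟩
  ∑[ v < n ] (if v == x then ⟦ P v ⟧ else 0) + ∑[ v < n ] ⟦ U v ∧ P v ⟧
    ≡⟨ cong₂ _+_ (∑-δ x (λ v → ⟦ P v ⟧)) (sym (count≡∑ (λ v → U v ∧ P v))) ⟩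
  ⟦ P x ⟧ + count (λ v → U v ∧ P v)
    ∎
  where
  open ≡-Reasoning
  split : ∀ v → ⟦ insert x U v ∧ P v ⟧
                ≡ (if v == x then ⟦ P v ⟧ else 0) + ⟦ U v ∧ P v ⟧
  split v with v ≟ x
  ... | yes refl rewrite Ux = sym (+-identityʳ _)
  ... | no  _    = refl

length-filterᵇ : ∀ {A : Set} (p : A → Bool) xs →
                 length (filterᵇ p xs) ≡ sum (map (λ x → ⟦ p x ⟧) xs)
length-filterᵇ p []       = refl
length-filterᵇ p (x ∷ xs) with p x
... | true  = cong suc (length-filterᵇ p xs)
... | false = length-filterᵇ p xs

-- Round trips

roundTrips : ∀ {n} → Fin n → Fin n → ℕ → (Fin n → ℕ) → Fin n → ℕ
roundTrips x y t d z = d z + 2 * (t * (⟦ x == z ⟧ + ⟦ y == z ⟧))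

module _ {n : ℕ} {x y : Fin n} (t : ℕ) (d : Fin n → ℕ) where

  roundTrips-source : x ≢ y → roundTrips x y t d x ≡ d x + 2 * t
  roundTrips-source x≢y
    rewrite dec-true (x ≟ x) refl | dec-false (y ≟ x) (x≢y ∘ sym) | *-identityʳ t = refl

  roundTrips-target : x ≢ y → roundTrips x y t d y ≡ d y + 2 * t
  roundTrips-target x≢y
    rewrite dec-false (x ≟ y) x≢y | dec-true (y ≟ y) refl | *-identityʳ t = refl

  roundTrips-elsewhere : ∀ {z} → x ≢ z → y ≢ z → roundTrips x y t d z ≡ d z
  roundTrips-elsewhere {z} x≢z y≢z
    rewrite dec-false (x ≟ z) x≢z | dec-false (y ≟ z) y≢z | *-zeroʳ t = +-identityʳ (d z)

  roundTrips-source-apart : x ≢ y → ∀ {z} → x ≢ z → y ≢ z → d x + 2 * t ≢ d z →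
                            roundTrips x y t d x ≢ roundTrips x y t d z
  roundTrips-source-apart x≢y x≢z y≢z apart same =
    apart (trans (sym (roundTrips-source x≢y)) (trans same (roundTrips-elsewhere x≢z y≢z)))

  roundTrips-target-apart : x ≢ y → ∀ {z} → x ≢ z → y ≢ z → d y + 2 * t ≢ d z →
                            roundTrips x y t d y ≢ roundTrips x y t d z
  roundTrips-target-apart x≢y x≢z y≢z apart same =
    apart (trans (sym (roundTrips-target x≢y)) (trans same (roundTrips-elsewhere x≢z y≢z)))

  roundTrips-ends-apart : x ≢ y → d x ≢ d y → roundTrips x y t d x ≢ roundTrips x y t d y
  roundTrips-ends-apart x≢y apart same = apart (+-cancelʳ-≡ (2 * t) (d x) (d y)
    (trans (sym (roundTrips-source x≢y)) (trans same (roundTrips-target x≢y))))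

pigeonhole-∈ : (F : List ℕ) → ¬ (∀ (t : Fin (suc (length F))) → toℕ t ∈ F)
pigeonhole-∈ F every with pigeonhole (n<1+n (length F)) (index ∘ every)
... | i , j , i<j , same-index = <⇒≢ᶠ i<j (toℕ-injective (begin
  toℕ i                      ≡⟨ lookup-index (every i) ⟩
  lookup F (index (every i)) ≡⟨ cong (lookup F) same-index ⟩
  lookup F (index (every j)) ≡⟨ sym (lookup-index (every j)) ⟩
  toℕ j                      ∎))
  where open ≡-Reasoning

fresh : (F : List ℕ) → ∃ λ t → t ≤ length F × t ∉ F
fresh F with any? (λ (t : Fin (suc (length F))) → ¬? (toℕ t ∈ℕ? F))
... | yes (t , t∉F) = toℕ t , toℕ≤pred[n] t , t∉F
... | no  none      = contradiction every (pigeonhole-∈ F)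
  where
  every : ∀ t → toℕ t ∈ F
  every t = decidable-stable (toℕ t ∈ℕ? F) (λ t∉F → none (t , t∉F))

halfGap : ℕ × ℕ → ℕ
halfGap (a , b) = (b ∸ a) / 2

halfGap-inverts : ∀ {a t b} → a + 2 * t ≡ b → halfGap (a , b) ≡ t
halfGap-inverts {a} {t} refl = begin
  (a + 2 * t ∸ a) / 2 ≡⟨ cong (_/ 2) (trans (m+n∸m≡n a (2 * t)) (*-comm 2 t)) ⟩
  t * 2 / 2           ≡⟨ m*n/n≡m t 2 ⟩
  t                   ∎
  where open ≡-Reasoning

avoid : (cs : List (ℕ × ℕ)) →
        ∃ λ t → t ≤ length cs × ∀ {a b} → (a , b) ∈ cs → a + 2 * t ≢ b
avoid cs with fresh (map halfGap cs)
... | t , t≤ , t∉ =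
  t , subst (t ≤_) (length-map halfGap cs) t≤ ,
  λ {a} ab∈cs a+2t≡b →
    t∉ (subst (_∈ map halfGap cs) (halfGap-inverts {a} a+2t≡b) (∈-map⁺ halfGap ab∈cs))

-- Vertex lists as walks

Linked-lookup : ∀ {A : Set} {R : A → A → Set} {a rest} → Linked R (a ∷ rest) →
                (i : Fin (length rest)) →
                R (lookup (a ∷ rest) (inject₁ i)) (lookup (a ∷ rest) (fs i))
Linked-lookup (r ∷ _) fz     = r
Linked-lookup (_ ∷ l) (fs i) = Linked-lookup l i

module _ {A : Set} {x y : A} {zs : List A} where

  Linked-detour : ∀ {R : A → A → Set} ys → Linked R (ys ++ x ∷ zs) → R x y → R y x →
                  Linked R (ys ++ x ∷ y ∷ x ∷ zs)
  Linked-detour []           l        xy yx = xy ∷ yx ∷ l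
  Linked-detour (a ∷ [])     (ax ∷ l) xy yx = ax ∷ Linked-detour [] l xy yx
  Linked-detour (a ∷ b ∷ ys) (ab ∷ l) xy yx = ab ∷ Linked-detour (b ∷ ys) l xy yx

  ∈-detour : ∀ ys {v} → v ∈ ys ++ x ∷ zs → v ∈ ys ++ x ∷ y ∷ x ∷ zs
  ∈-detour []       (here v≡x) = here v≡x
  ∈-detour []       (there v∈) = there (there (there v∈))
  ∈-detour (a ∷ ys) (here v≡a) = here v≡a
  ∈-detour (a ∷ ys) (there v∈) = there (∈-detour ys v∈)

  length-detour : ∀ ys → length (ys ++ x ∷ y ∷ x ∷ zs) ≡ 2 + length (ys ++ x ∷ zs)
  length-detour []       = refl
  length-detour (a ∷ ys) = cong suc (length-detour ys)

trailDeg : ∀ {n} → List (Fin n) → Fin n → ℕ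
trailDeg (a ∷ b ∷ xs) z = (⟦ a == z ⟧ + ⟦ b == z ⟧) + trailDeg (b ∷ xs) z
trailDeg _            z = 0

module _ {n} {x y : Fin n} {zs : List (Fin n)} where

  trailDeg-detour : ∀ ys z → trailDeg (ys ++ x ∷ y ∷ x ∷ zs) z
                            ≡ trailDeg (ys ++ x ∷ zs) z + 2 * (⟦ x == z ⟧ + ⟦ y == z ⟧)
  trailDeg-detour [] z = arrange ⟦ x == z ⟧ ⟦ y == z ⟧ (trailDeg (x ∷ zs) z)
    where
    arrange : ∀ a b r → (a + b) + ((b + a) + r) ≡ r + 2 * (a + b)
    arrange = solve-∀
  trailDeg-detour (a ∷ []) z =
    trans (cong (⟦ a == z ⟧ + ⟦ x == z ⟧ +_) (trailDeg-detour [] z))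
          (sym (+-assoc (⟦ a == z ⟧ + ⟦ x == z ⟧) (trailDeg (x ∷ zs) z) _))
  trailDeg-detour (a ∷ b ∷ ys) z =
    trans (cong (⟦ a == z ⟧ + ⟦ b == z ⟧ +_) (trailDeg-detour (b ∷ ys) z))
          (sym (+-assoc (⟦ a == z ⟧ + ⟦ b == z ⟧) (trailDeg (b ∷ ys ++ x ∷ zs) z) _))

module _ {n : ℕ} (G : Graph n) where

  open DecMembership (_≟_ {n}) using (_∈?_)

  Adj-sym : ∀ {u v} → Adj G u v → Adj G v u
  Adj-sym {u} {v} uv = trans (Graph.sym G v u) uv

  Adj⇒≢ : ∀ {u v} → Adj G u v → u ≢ v
  Adj⇒≢ {u} uv refl = contradiction (trans (sym (Graph.irrefl G u)) uv) λ ()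

  tail : ∀ {ℓ} → Walk G (suc ℓ) → Walk G ℓ
  tail W = record { vtx = vtx W ∘ fs ; step = step W ∘ fs }

  vertices : ∀ {ℓ} → Walk G ℓ → List (Fin n)
  vertices W = tabulate (vtx W)

  walkDeg-tail : ∀ {ℓ} (W : Walk G (suc ℓ)) z →
    walkDeg W z ≡ (⟦ vtx W fz == z ⟧ + ⟦ vtx W (fs fz) == z ⟧) + walkDeg (tail W) z
  walkDeg-tail W z =
    trans (cong₂ _+_ (count-suc (λ i → vtx W (inject₁ i) == z))
                     (count-suc (λ i → vtx W (fs i) == z)))
          (interchange ⟦ vtx W fz == z ⟧ _ ⟦ vtx W (fs fz) == z ⟧ _)

  walkDeg≡trailDeg : ∀ {ℓ} (W : Walk G ℓ) z → walkDeg W z ≡ trailDeg (vertices W) z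
  walkDeg≡trailDeg {zero}  W z = refl
  walkDeg≡trailDeg {suc ℓ} W z =
    trans (walkDeg-tail W z)
          (cong (⟦ vtx W fz == z ⟧ + ⟦ vtx W (fs fz) == z ⟧ +_) (walkDeg≡trailDeg (tail W) z))

  Linked-vertices : ∀ {ℓ} (W : Walk G ℓ) → Linked (Adj G) (vertices W)
  Linked-vertices {zero}  W = [-]
  Linked-vertices {suc ℓ} W = step W fz ∷ Linked-vertices (tail W)

  ∈-vertices : ∀ {ℓ} (W : Walk G ℓ) → Spanning W → ∀ v → v ∈ vertices W
  ∈-vertices W visits v with visits v
  ... | i , refl = ∈-tabulate⁺ {f = vtx W} i

  walk-of-trail : ∀ {ℓ} (xs : List (Fin n)) → Linked (Adj G) xs → length xs ≡ suc ℓ →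
                  Σ (Walk G ℓ) λ W → ∀ z → walkDeg W z ≡ trailDeg xs z
  walk-of-trail (a ∷ rest) linked refl = W , λ z →
    trans (walkDeg≡trailDeg W z) (cong (λ xs → trailDeg xs z) (tabulate-lookup (a ∷ rest)))
    where
    W : Walk G (length rest)
    W = record { vtx = lookup (a ∷ rest) ; step = Linked-lookup linked }

  -- Connectivity

  walk-leaves : ∀ {ℓ L} (W : Walk G ℓ) → first W ∈ L → last W ∉ L →
                ∃ λ i → vtx W (inject₁ i) ∈ L × vtx W (fs i) ∉ L
  walk-leaves {zero}      W first∈L last∉L = contradiction first∈L last∉L
  walk-leaves {suc ℓ} {L} W first∈L last∉L with vtx W (fs fz) ∈? L
  ... | no  next∉L = fz , first∈L , next∉L
  ... | yes next∈L with walk-leaves (tail W) next∈L last∉L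
  ...   | i , inside , beyond = fs i , inside , beyond

  exit-edge : Connected G → ∀ {a b L} → a ∈ L → b ∉ L →
              ∃₂ λ y x → y ∈ L × x ∉ L × Adj G y x
  exit-edge connected {a} {b} a∈L b∉L with connected a b
  ... | _ , W , refl , refl with walk-leaves W a∈L b∉L
  ...   | i , y∈L , x∉L = _ , _ , y∈L , x∉L , step W i

  outside : List (Fin n) → Fin n → Bool
  outside L v = not (does (v ∈? L))

  outside-∈ : ∀ {L v} → v ∈ L → outside L v ≡ false
  outside-∈ {L} {v} v∈L = cong not (dec-true (v ∈? L) v∈L)

  outside-∉ : ∀ {L v} → outside L v ≡ true → v ∉ L
  outside-∉ out v∈L = contradiction (trans (sym out) (outside-∈ v∈L)) λ ()

  outside-∷ : ∀ {x L} → x ∉ L → ∀ v → outside L v ≡ insert x (outside (x ∷ L)) v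
  outside-∷ {x} {L} x∉L v with v ≟ x
  ... | yes refl = cong not (dec-false (v ∈? L) x∉L)
  ... | no  _    = refl

  count-outside-∷ : ∀ {x L} → x ∉ L → (P : Fin n → Bool) →
                    count (λ v → outside L v ∧ P v)
                    ≡ ⟦ P x ⟧ + count (λ v → outside (x ∷ L) v ∧ P v)
  count-outside-∷ {x} {L} x∉L P =
    trans (count-cong {Q = λ v → insert x (outside (x ∷ L)) v ∧ P v}
                      (λ v → cong (_∧ P v) (outside-∷ x∉L v)))
          (count-insert (outside-∈ {x ∷ L} (here refl)) P)

  data Grown (R : List (Fin n)) : List (Fin n) → Set where
    root : Grown R R
    grow : ∀ {x y L} → x ∉ L → y ∈ L → Adj G x y → Grown R L → Grown R (x ∷ L)

  spanning-growth : Connected G → ∀ {R a} → a ∈ R → ∃ λ L → Grown R L × (∀ v → v ∈ L)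
  spanning-growth connected {R} {a} a∈R = extend _ refl root a∈R
    where
    unreached : List (Fin n) → ℕ
    unreached L = count (λ v → outside L v ∧ true)
    extend : ∀ m {L} → unreached L ≡ m → Grown R L → a ∈ L →
             ∃ λ L′ → Grown R L′ × (∀ v → v ∈ L′)
    extend m {L} unreached≡m grown a∈L with all? (_∈? L)
    ... | yes spans = L , grown , spans
    ... | no ¬spans
      with exit-edge connected a∈L (proj₂ (¬∀⟶∃¬ n (_∈ L) (_∈? L) ¬spans)) | m
    ...   | _ , _ , _ , x∉L , _ | zero =
      contradiction (trans (sym (count-outside-∷ x∉L (λ _ → true))) unreached≡m) λ ()
    ...   | _ , _ , y∈L , x∉L , yx | suc m′ =
      extend m′ (suc-injective (trans (sym (count-outside-∷ x∉L (λ _ → true))) unreached≡m))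
             (grow x∉L y∈L (Adj-sym yx) grown) (there a∈L)

  cherry : Connected G → ∀ {a b c} → a ≢ b → a ≢ c → b ≢ c →
           ∃ λ r → ∃₂ λ s w → Adj G w r × Adj G s r × w ≢ s
  cherry connected {a} {b} {c} a≢b a≢c b≢c
    with exit-edge connected {L = a ∷ []} (here refl)
                   (λ { (here b≡a) → a≢b (sym b≡a) ; (there ()) })
  ... | _ , _ , there () , _ , _
  ... | _ , x , here refl , _ , ax with third
    where
    third : ∃ λ v → v ∉ a ∷ x ∷ []
    third with x ≟ b
    ... | yes refl = c , λ { (here c≡a)         → a≢c (sym c≡a)
                           ; (there (here c≡x)) → b≢c (sym c≡x)
                           ; (there (there ())) }
    ... | no  x≢b  = b , λ { (here b≡a)         → a≢b (sym b≡a)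
                           ; (there (here b≡x)) → x≢b (sym b≡x)
                           ; (there (there ())) }
  ...   | _ , v∉ with exit-edge connected (here refl) v∉
  ...     | _ , z , here refl , z∉ , az =
    a , x , z , Adj-sym az , Adj-sym ax , λ z≡x → z∉ (there (here z≡x))
  ...     | _ , z , there (here refl) , z∉ , xz =
    x , a , z , Adj-sym xz , ax , λ z≡a → z∉ (here z≡a)

  -- Edges inside a vertex set

  orderedEdge : Fin n → Fin n → Bool
  orderedEdge u v = does (u <? v) ∧ adj G u v

  orderedEdge-irrefl : ∀ u → orderedEdge u u ≡ false
  orderedEdge-irrefl u rewrite Graph.irrefl G u = ∧-zeroʳ _

  orderedEdge-either : ∀ x v → ⟦ orderedEdge v x ⟧ + ⟦ orderedEdge x v ⟧ ≡ ⟦ adj G x v ⟧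
  orderedEdge-either x v rewrite Graph.sym G v x with adj G x v in xv | <-cmp x v
  ... | false | _ rewrite ∧-zeroʳ (does (v <? x)) | ∧-zeroʳ (does (x <? v)) = refl
  ... | true  | tri< x<v _ v≮x rewrite dec-false (v <? x) v≮x | dec-true (x <? v) x<v = refl
  ... | true  | tri> x≮v _ v<x rewrite dec-true (v <? x) v<x | dec-false (x <? v) x≮v = refl
  ... | true  | tri≈ _ refl _ = ⊥-elim (Adj⇒≢ xv refl)

  edgesIn : (Fin n → Bool) → ℕ
  edgesIn U = ∑[ u < n ] (if U u then count (λ v → U v ∧ orderedEdge u v) else 0)

  edgesIn-all : edgesIn (λ _ → true) ≡ numEdges G
  edgesIn-all = sym (sum-allFin (λ u → count (orderedEdge u)))

  edgesIn-cong : ∀ {U V} → (∀ v → U v ≡ V v) → edgesIn U ≡ edgesIn V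
  edgesIn-cong {U} {V} U≗V = sum-cong-≗ λ u →
    cong₂ (λ b c → if b then c else 0) (U≗V u)
          (count-cong {P = λ v → U v ∧ orderedEdge u v}
                      (λ v → cong (_∧ orderedEdge u v) (U≗V v)))

  edgesIn-insert : ∀ {U x} → U x ≡ false →
                   edgesIn (insert x U) ≡ edgesIn U + count (λ v → U v ∧ adj G x v)
  edgesIn-insert {U} {x} Ux = begin
    edgesIn (insert x U)
      ≡⟨ sum-cong-≗ row-insert ⟩
    ∑[ u < n ] (row u + (toward u + atX u))
      ≡⟨ ∑-distrib-+ row (λ u → toward u + atX u) ⟩
    edgesIn U + ∑[ u < n ] (toward u + atX u)
      ≡⟨ cong (edgesIn U +_) (∑-distrib-+ toward atX) ⟩
    edgesIn U + (∑[ u < n ] toward u + ∑[ u < n ] atX u)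
      ≡⟨ cong (edgesIn U +_) (cong₂ _+_ (sym (count≡∑ (λ u → U u ∧ orderedEdge u x)))
                                        (∑-δ x (λ _ → fromX))) ⟩
    edgesIn U + (count (λ v → U v ∧ orderedEdge v x) + fromX)
      ≡⟨ cong (edgesIn U +_) (count-+ split) ⟩
    edgesIn U + count (λ v → U v ∧ adj G x v)
      ∎
    where
    open ≡-Reasoning
    fromX : ℕ
    fromX = count (λ v → U v ∧ orderedEdge x v)
    above row toward atX : Fin n → ℕ
    above u  = count (λ v → U v ∧ orderedEdge u v)
    row u    = if U u then above u else 0
    toward u = ⟦ U u ∧ orderedEdge u x ⟧
    atX u    = if u == x then fromX else 0
    row-insert : ∀ u → (if insert x U u then count (λ v → insert x U v ∧ orderedEdge u v) else 0)
                       ≡ row u + (toward u + atX u)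
    row-insert u with u ≟ x
    ... | yes refl rewrite Ux =
      trans (count-insert Ux (orderedEdge u)) (cong (λ b → ⟦ b ⟧ + fromX) (orderedEdge-irrefl u))
    ... | no  _ with U u
    ...   | true  = trans (count-insert Ux (orderedEdge u))
                          (trans (+-comm ⟦ orderedEdge u x ⟧ (above u))
                                 (cong (above u +_) (sym (+-identityʳ ⟦ orderedEdge u x ⟧))))
    ...   | false = refl
    split : ∀ v → ⟦ U v ∧ orderedEdge v x ⟧ + ⟦ U v ∧ orderedEdge x v ⟧
                  ≡ ⟦ U v ∧ adj G x v ⟧
    split v with U v
    ... | true  = orderedEdge-either x v
    ... | false = refl

  ProperOn : (Fin n → Bool) → (Fin n → ℕ) → Set
  ProperOn U d = ∀ {a b} → U a ≡ true → U b ≡ true → Adj G a b → d a ≢ d b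

  ProperOn-resp : ∀ {U V d} → (∀ v → U v ≡ V v) → ProperOn U d → ProperOn V d
  ProperOn-resp U≗V proper Va Vb = proper (trans (U≗V _) Va) (trans (U≗V _) Vb)

  ProperOn-insert : ∀ {U d x} → ProperOn U d →
                    (∀ {v} → U v ≡ true → Adj G x v → d x ≢ d v) → ProperOn (insert x U) d
  ProperOn-insert {U} {x = x} proper apart {a} {b} a∈ b∈ ab
    with insert-true {x = x} {U} {a} a∈ | insert-true {x = x} {U} {b} b∈
  ... | inj₁ refl | inj₁ refl = ⊥-elim (Adj⇒≢ ab refl)
  ... | inj₁ refl | inj₂ Ub   = apart Ub ab
  ... | inj₂ Ua   | inj₁ refl = apart Ua (Adj-sym ab) ∘ sym
  ... | inj₂ Ua   | inj₂ Ub   = proper Ua Ub ab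

  neighboursIn : (Fin n → Bool) → Fin n → List (Fin n)
  neighboursIn U x = filterᵇ (λ v → U v ∧ adj G x v) (allFin n)

  conflicts : (Fin n → ℕ) → (Fin n → Bool) → Fin n → List (ℕ × ℕ)
  conflicts d U x = map (λ v → d x , d v) (neighboursIn U x)

  length-conflicts : ∀ d U x → length (conflicts d U x) ≡ count (λ v → U v ∧ adj G x v)
  length-conflicts d U x =
    trans (length-map _ (neighboursIn U x)) (length-filterᵇ (λ v → U v ∧ adj G x v) (allFin n))

  ∈-conflicts : ∀ {d U x v} → U v ≡ true → Adj G x v → (d x , d v) ∈ conflicts d U x
  ∈-conflicts {d} {U} {x} {v} Uv xv =
    ∈-map⁺ (λ v → d x , d v) (∈-filter⁺ (T? ∘ (λ v → U v ∧ adj G x v)) (∈-allFin v)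
                                         (subst T (sym (cong₂ _∧_ Uv xv)) tt))

  -- Settling the vertices

  module _ (p : ℕ) where

    -- c * 2 rather than 2 * c, so that one more round trip adds 2 to the length definitionally.
    record Tour (d : Fin n → ℕ) (c : ℕ) : Set where
      field
        trail   : List (Fin n)
        linked  : Linked (Adj G) trail
        visits  : ∀ v → v ∈ trail
        length≡ : length trail ≡ suc (c * 2 + p)
        degree≡ : ∀ z → deg G z + trailDeg trail z ≡ d z

    retarget : ∀ {d d′ c} → (∀ z → d z ≡ d′ z) → Tour d c → Tour d′ c
    retarget d≗d′ T = record
      { trail = trail ; linked = linked ; visits = visits ; length≡ = length≡
      ; degree≡ = λ z → trans (degree≡ z) (d≗d′ z) }
      where open Tour T

    detour : ∀ {d c x y} → Tour d c → Adj G x y →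
             Tour (λ z → d z + 2 * (⟦ x == z ⟧ + ⟦ y == z ⟧)) (suc c)
    detour {d} {c} {x} {y} T xy with ∈-∃++ (Tour.visits T x)
    ... | ys , zs , split = record
      { trail   = ys ++ x ∷ y ∷ x ∷ zs
      ; linked  = Linked-detour ys (subst (Linked (Adj G)) split linked) xy (Adj-sym xy)
      ; visits  = λ v → ∈-detour {y = y} ys (subst (v ∈_) split (visits v))
      ; length≡ = trans (length-detour {y = y} ys)
                        (cong (2 +_) (trans (cong length (sym split)) length≡))
      ; degree≡ = λ z → begin
          deg G z + trailDeg (ys ++ x ∷ y ∷ x ∷ zs) z
            ≡⟨ cong (deg G z +_) (trailDeg-detour ys z) ⟩
          deg G z + (trailDeg (ys ++ x ∷ zs) z + bonus z)
            ≡⟨ sym (+-assoc (deg G z) _ (bonus z)) ⟩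
          deg G z + trailDeg (ys ++ x ∷ zs) z + bonus z
            ≡⟨ cong (λ xs → deg G z + trailDeg xs z + bonus z) (sym split) ⟩
          deg G z + trailDeg trail z + bonus z
            ≡⟨ cong (_+ bonus z) (degree≡ z) ⟩
          d z + bonus z
            ∎
      }
      where
      open Tour T
      open ≡-Reasoning
      bonus : Fin n → ℕ
      bonus z = 2 * (⟦ x == z ⟧ + ⟦ y == z ⟧)

    Tour-roundTrips : ∀ {d c x y} → Tour d c → Adj G x y → ∀ t →
                      Tour (roundTrips x y t d) (t + c)
    Tour-roundTrips {d} T xy zero = retarget (λ z → sym (+-identityʳ (d z))) T
    Tour-roundTrips {d} {x = x} {y} T xy (suc t) =
      retarget (λ z → arrange (d z) t (⟦ x == z ⟧ + ⟦ y == z ⟧))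
               (detour (Tour-roundTrips T xy t) xy)
      where
      arrange : ∀ a t k → (a + 2 * (t * k)) + 2 * k ≡ a + 2 * (suc t * k)
      arrange = solve-∀

    -- The vertices outside L are settled: their degrees are final and differ along edges,
    -- and the round trips made so far are paid for by the edges among them, up to slack.
    record Progress (L : List (Fin n)) (slack : ℕ) : Set where
      field
        degrees : Fin n → ℕ
        cost    : ℕ
        tour    : Tour degrees cost
        proper  : ProperOn (outside L) degrees
        bounded : cost ≤ edgesIn (outside L) + slack
    open Progress

    start : ∀ {L} (W : Walk G p) → Spanning W → (∀ v → v ∈ L) → Progress L 0
    start W visits spans = record
      { degrees = degPlus W
      ; cost    = 0
      ; tour    = record
        { trail   = vertices W
        ; linked  = Linked-vertices W
        ; visits  = ∈-vertices W visits
        ; length≡ = length-tabulate (vtx W)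
        ; degree≡ = λ z → cong (deg G z +_) (sym (walkDeg≡trailDeg W z))
        }
      ; proper  = λ out _ _ → ⊥-elim (outside-∉ out (spans _))
      ; bounded = z≤n
      }

    raise : ∀ {L k x y} → x ∈ L → y ∈ L → Adj G x y → Progress L k → ∀ t →
            Progress L (k + t)
    raise {L} {k} {x} {y} x∈L y∈L xy P t = record
      { degrees = roundTrips x y t (degrees P)
      ; cost    = t + cost P
      ; tour    = Tour-roundTrips (tour P) xy t
      ; proper  = λ Ua Ub ab same →
          proper P Ua Ub ab (trans (sym (unchanged Ua)) (trans same (unchanged Ub)))
      ; bounded = begin
          t + cost P                         ≤⟨ +-monoʳ-≤ t (bounded P) ⟩
          t + (edgesIn (outside L) + k)      ≡⟨ +-comm t _ ⟩
          edgesIn (outside L) + k + t        ≡⟨ +-assoc (edgesIn (outside L)) k t ⟩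
          edgesIn (outside L) + (k + t)      ∎
      }
      where
      open ≤-Reasoning
      unchanged : ∀ {v} → outside L v ≡ true → roundTrips x y t (degrees P) v ≡ degrees P v
      unchanged out = roundTrips-elsewhere {x = x} {y} t (degrees P)
                        (λ { refl → outside-∉ out x∈L }) (λ { refl → outside-∉ out y∈L })

    join : ∀ {L k j x} → x ∉ L → (P : Progress (x ∷ L) k) →
           (∀ {v} → outside (x ∷ L) v ≡ true → Adj G x v → degrees P x ≢ degrees P v) →
           k ≤ j + count (λ v → outside (x ∷ L) v ∧ adj G x v) → Progress L j
    join {L} {k} {j} {x} x∉L P apart k≤ = record
      { degrees = degrees P
      ; cost    = cost P
      ; tour    = tour P
      ; proper  = ProperOn-resp (λ v → sym (outside-∷ x∉L v)) (ProperOn-insert (proper P) apart)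
      ; bounded = begin
          cost P                          ≤⟨ bounded P ⟩
          edgesIn U + k                   ≤⟨ +-monoʳ-≤ (edgesIn U) k≤ ⟩
          edgesIn U + (j + N)             ≡⟨ cong (edgesIn U +_) (+-comm j N) ⟩
          edgesIn U + (N + j)             ≡⟨ sym (+-assoc (edgesIn U) N j) ⟩
          edgesIn U + N + j
            ≡⟨ cong (_+ j) (sym (edgesIn-insert (outside-∈ {x ∷ L} (here refl)))) ⟩
          edgesIn (insert x U) + j
            ≡⟨ cong (_+ j) (sym (edgesIn-cong (outside-∷ x∉L))) ⟩
          edgesIn (outside L) + j         ∎
      }
      where
      open ≤-Reasoning
      U : Fin n → Bool
      U = outside (x ∷ L)
      N : ℕ
      N = count (λ v → U v ∧ adj G x v)

    settle : ∀ {L k j x y} → x ∉ L → y ∈ L → Adj G x y → (P : Progress (x ∷ L) k) → ∀ t →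
             (∀ {v} → outside (x ∷ L) v ≡ true → Adj G x v →
                      degrees P x + 2 * t ≢ degrees P v) →
             k + t ≤ j + count (λ v → outside (x ∷ L) v ∧ adj G x v) → Progress L j
    settle {L} {x = x} {y} x∉L y∈L xy P t apart =
      join x∉L (raise (here refl) (there y∈L) xy P t) λ {v} out xv →
        roundTrips-source-apart t (degrees P) (Adj⇒≢ xy) {v}
          (λ { refl → outside-∉ {x ∷ L} out (here refl) })
          (λ { refl → outside-∉ {x ∷ L} out (there y∈L) })
          (apart out xv)

    settleLeaf : ∀ {L k x y} → x ∉ L → y ∈ L → Adj G x y →
                 Progress (x ∷ L) k → Progress L k
    settleLeaf {L} {k} {x} x∉L y∈L xy P with avoid (conflicts (degrees P) (outside (x ∷ L)) x)
    ... | t , t≤ , avoids =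
      settle x∉L y∈L xy P t (λ out xv → avoids (∈-conflicts out xv))
             (+-monoʳ-≤ k (subst (t ≤_) (length-conflicts (degrees P) (outside (x ∷ L)) x) t≤))

    run : ∀ {R L} → Grown R L → Progress L 0 → Progress R 0
    run root                    P = P
    run (grow x∉L y∈L xy grown) P = run grown (settleLeaf x∉L y∈L xy P)

    settleFirstChild : ∀ {r s w} → Adj G w r → w ≢ s → s ≢ r →
                       (P : Progress (w ∷ s ∷ r ∷ []) 0) →
                       Σ (Progress (s ∷ r ∷ []) 1) λ P₁ → degrees P₁ s ≢ degrees P₁ r
    settleFirstChild {r} {s} {w} wr w≢s s≢r P
      with avoid ((degrees P r , degrees P s) ∷ conflicts (degrees P) (outside (w ∷ s ∷ r ∷ [])) w)
    ... | t , t≤ , avoids =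
      settle w∉ (there (here refl)) wr P t (λ out wv → avoids (there (∈-conflicts out wv)))
             (subst (t ≤_) (cong suc (length-conflicts _ (outside (w ∷ s ∷ r ∷ [])) w)) t≤) ,
      λ same → roundTrips-target-apart t (degrees P) (Adj⇒≢ wr) w≢s (s≢r ∘ sym)
                                       (avoids (here refl)) (sym same)
      where
      w∉ : w ∉ s ∷ r ∷ []
      w∉ (here w≡s)         = w≢s w≡s
      w∉ (there (here w≡r)) = Adj⇒≢ wr w≡r

    settleLastChild : ∀ {r s} → Adj G s r → (P : Progress (s ∷ r ∷ []) 1) →
                      degrees P s ≢ degrees P r → Progress [] 0
    settleLastChild {r} {s} sr P s≉r
      with avoid (conflicts (degrees P) (outside (s ∷ r ∷ [])) s ++
                  conflicts (degrees P) (outside (s ∷ r ∷ [])) r)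
    ... | t , t≤ , avoids = join (λ ()) P₂ apart (≤-reflexive count-r)
      where
      open ≡-Reasoning
      d : Fin n → ℕ
      d = degrees P
      U : Fin n → Bool
      U = outside (s ∷ r ∷ [])
      Ns Nr : ℕ
      Ns = count (λ v → U v ∧ adj G s v)
      Nr = count (λ v → U v ∧ adj G r v)
      s∉ : s ∉ r ∷ []
      s∉ (here s≡r) = Adj⇒≢ sr s≡r
      bound : 1 + t ≤ (1 + Nr) + Ns
      bound = s≤s (subst (t ≤_) (begin
        length (conflicts d U s ++ conflicts d U r)         ≡⟨ length-++ (conflicts d U s) ⟩
        length (conflicts d U s) + length (conflicts d U r) ≡⟨ cong₂ _+_ (length-conflicts d U s)
                                                                         (length-conflicts d U r) ⟩
        Ns + Nr                                             ≡⟨ +-comm Ns Nr ⟩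
        Nr + Ns                                             ∎) t≤)
      P₂ : Progress (r ∷ []) (1 + Nr)
      P₂ = settle s∉ (here refl) sr P t (λ out sv → avoids (∈-++⁺ˡ (∈-conflicts out sv))) bound
      count-r : 1 + Nr ≡ count (λ v → outside (r ∷ []) v ∧ adj G r v)
      count-r = sym (trans (count-outside-∷ s∉ (adj G r)) (cong (λ b → ⟦ b ⟧ + Nr) (Adj-sym sr)))
      apart : ∀ {v} → outside (r ∷ []) v ≡ true → Adj G r v → degrees P₂ r ≢ degrees P₂ v
      apart {v} out rv with insert-true {x = s} {U} {v} (trans (sym (outside-∷ s∉ v)) out)
      ... | inj₁ refl = roundTrips-ends-apart t d (Adj⇒≢ sr) s≉r ∘ sym
      ... | inj₂ Uv   = roundTrips-target-apart t d (Adj⇒≢ sr) {v}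
                          (λ { refl → outside-∉ {s ∷ r ∷ []} Uv (here refl) })
                          (λ { refl → outside-∉ {s ∷ r ∷ []} Uv (there (here refl)) })
                          (avoids (∈-++⁺ʳ (conflicts d U s) (∈-conflicts Uv rv)))

    realise : Progress [] 0 → MLW≤ G (p + 2 * numEdges G)
    realise P = cost P * 2 + p , length≤ , W , irregular
      where
      open Tour (tour P)
      walk : Σ (Walk G (cost P * 2 + p)) λ W → ∀ z → walkDeg W z ≡ trailDeg trail z
      walk = walk-of-trail trail linked length≡
      W : Walk G (cost P * 2 + p)
      W = proj₁ walk
      cost≤ : cost P ≤ numEdges G
      cost≤ = subst (cost P ≤_) (trans (+-identityʳ _) edgesIn-all) (bounded P)
      length≤ : cost P * 2 + p ≤ p + 2 * numEdges G
      length≤ = begin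
        cost P * 2 + p      ≡⟨ +-comm (cost P * 2) p ⟩
        p + cost P * 2      ≡⟨ cong (p +_) (*-comm (cost P) 2) ⟩
        p + 2 * cost P      ≤⟨ +-monoʳ-≤ p (*-monoʳ-≤ 2 cost≤) ⟩
        p + 2 * numEdges G  ∎
        where open ≤-Reasoning
      degPlus≡ : ∀ z → degPlus W z ≡ degrees P z
      degPlus≡ z = trans (cong (deg G z +_) (proj₂ walk z)) (degree≡ z)
      irregular : Irregularising W
      irregular u v uv same =
        proper P refl refl uv (trans (sym (degPlus≡ u)) (trans same (degPlus≡ v)))

  MLW≤-from-cherry : Connected G → ∀ {r s w} → Adj G w r → Adj G s r → w ≢ s →
                     ∀ {p} (W : Walk G p) → Spanning W → MLW≤ G (p + 2 * numEdges G)
  MLW≤-from-cherry connected {r} {s} {w} wr sr w≢s {p} W visits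
    with spanning-growth connected {w ∷ s ∷ r ∷ []} (here refl)
  ... | L , grown , spans
    with settleFirstChild p wr w≢s (Adj⇒≢ sr) (run p grown (start p W visits spans))
  ...   | P₁ , s≉r = realise p (settleLastChild p sr P₁ s≉r)

connected₂≅K₂ : (G : Graph 2) → Connected G → Isomorphic G K₂
connected₂≅K₂ G connected = ⤖-id (Fin 2) , same-adjacency
  where
  adj01 : Adj G fz (fs fz)
  adj01 with exit-edge G connected {b = fs fz} {L = fz ∷ []} (here refl)
                       (λ { (here ()) ; (there ()) })
  ... | _ , fz    , here refl , x∉ , _  = contradiction (here refl) x∉
  ... | _ , fs fz , here refl , _  , e = e
  same-adjacency : ∀ u v → adj G u v ≡ adj K₂ u v
  same-adjacency fz      fz      = Graph.irrefl G fz
  same-adjacency fz      (fs fz) = adj01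
  same-adjacency (fs fz) fz      = Adj-sym G adj01
  same-adjacency (fs fz) (fs fz) = Graph.irrefl G (fs fz)

theorem4p1 : ∀ {n : ℕ} (G : Graph n) → Nice G →
    ∀ (p : ℕ) (W : Walk G p) → Closed W → Spanning W →
    MLW≤ G (p + 2 * numEdges G)
theorem4p1 {zero} G _ p W _ _ with vtx W fz
... | ()
theorem4p1 {suc zero} G _ p W _ _ =
  0 , z≤n , stay , λ { fz fz loop → ⊥-elim (Adj⇒≢ G loop refl) }
  where
  stay : Walk G 0
  stay = record { vtx = λ _ → fz ; step = λ () }
theorem4p1 {suc (suc zero)} G (connected , ¬K₂) p W _ _ =
  ⊥-elim (¬K₂ (connected₂≅K₂ G connected))
theorem4p1 {suc (suc (suc n))} G (connected , _) p W _ visits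
  with cherry G connected {fz} {fs fz} {fs (fs fz)} (λ ()) (λ ()) (λ ())
... | _ , _ , _ , wr , sr , w≢s = MLW≤-from-cherry G connected wr sr w≢s W visits
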